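{- For every integer $n$, \[ \sum_{k=1}^n (-1)^{k-1}F_k^{\,4} = \frac{(-1)^{n-1}}{3}F_nF_{n+1}F_{n-2}F_{n+3} . \]
   Context: $F_n$ ($n\in\mathbb{Z}$) are the Fibonacci numbers: $F_n=F_{n-1}+F_{n-2}$ with $F_0=0$, $F_1=1$, extended to negative indices by $F_{ -n}=(-1)^{n-1}F_n$. For $n=0$ the sum $\sum_{k=1}^n$ is empty. For $n<0$ the sum follows the convention $\sum_{k=1}^n a_k=-\sum_{k=n+1}^{0}a_k$. -}

module Defs where

open import Data.Nat as ℕ using (ℕ; zero; suc)
open import Data.Integer using (ℤ; +_; -[1+_]; _+_; _*_; -_; ∣_∣; 0ℤ; 1ℤ)

fibℕ : ℕ → ℕ
fibℕ zero = 0
fibℕ (suc zero) = 1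
fibℕ (suc (suc n)) = fibℕ (suc n) ℕ.+ fibℕ n

negOnePow : ℕ → ℤ
negOnePow zero = 1ℤ
negOnePow (suc m) = - negOnePow m

-- (-1)^k for k : ℤ  (depends only on parity of |k|)
signℤ : ℤ → ℤ
signℤ k = negOnePow ∣ k ∣

-- Fibonacci numbers on ℤ, with F_{-n} = (-1)^(n-1) F_n
fib : ℤ → ℤ
fib (+ n) = + fibℕ n
fib -[1+ m ] = negOnePow m * (+ fibℕ (suc m))

sumFrom1 : (ℤ → ℤ) → ℕ → ℤ
sumFrom1 a zero = 0ℤ
sumFrom1 a (suc n) = sumFrom1 a n + a (+ suc n)

sumNeg : (ℤ → ℤ) → ℕ → ℤ
sumNeg a zero = a 0ℤ
sumNeg a (suc m) = sumNeg a m + a -[1+ m ]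

-- Σ_{k=1}^{n} a k for n : ℤ, with Σ_{k=1}^{n} a k = - Σ_{k=n+1}^{0} a k for n < 0
sumTo : (ℤ → ℤ) → ℤ → ℤ
sumTo a (+ n) = sumFrom1 a n
sumTo a -[1+ m ] = - sumNeg a m

{-# OPTIONS --safe #-}
module Submission where

-- Both sides change by 3 (-1)^n F_{n+1}^4 when n steps to n + 1: the sum by the definition of
-- sumTo (the convention for n < 0 is exactly what makes this hold on all of ℤ), the product by
--   F_{n-1} F_{n+1} F_{n+2} F_{n+4} + F_{n-2} F_n F_{n+1} F_{n+3} = 3 F_{n+1}^4,
-- a polynomial identity in F_{n-2}, F_{n-1} valid for every sequence obeying the Fibonacci
-- recurrence. Both sides vanish at n = 0, hence they agree everywhere.

open import Defs
open import Data.Nat as ℕ using (zero; suc)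
import Data.Nat.Properties as ℕ
open import Data.Integer using (ℤ; +_; -[1+_]; 0ℤ; _+_; _-_; _*_; _^_; -_)
open import Data.Integer.Properties
  using (+-assoc; +-identityʳ; +-inverseˡ; *-distribˡ-+; neg-involutive; pos-+; +-0-abelianGroup)
open import Algebra.Properties.AbelianGroup +-0-abelianGroup using (∙-cancelʳ)
open import Data.Integer.Tactic.RingSolver using (solve-∀; solve)
open import Data.List using (_∷_; [])
open import Relation.Binary.PropositionalEquality
open ≡-Reasoning

same-increments⇒≡ : (f g d : ℤ → ℤ) → f 0ℤ ≡ g 0ℤ →
  (∀ n → f (n + + 1) ≡ f n + d n) → (∀ n → g (n + + 1) ≡ g n + d n) → ∀ n → f n ≡ g n
same-increments⇒≡ f g d f0≡g0 f-inc g-inc = agree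
  where
  step : ∀ n → f n ≡ g n → f (n + + 1) ≡ g (n + + 1)
  step n e = trans (f-inc n) (trans (cong (_+ d n) e) (sym (g-inc n)))

  unstep : ∀ n → f (n + + 1) ≡ g (n + + 1) → f n ≡ g n
  unstep n e = ∙-cancelʳ (d n) (f n) (g n) (trans (sym (f-inc n)) (trans e (g-inc n)))

  agree : ∀ n → f n ≡ g n
  agree (+ zero)       = f0≡g0
  agree (+ suc m)      = subst (λ i → f i ≡ g i) (cong +_ (ℕ.+-comm m 1)) (step (+ m) (agree (+ m)))
  agree -[1+ zero ]    = unstep -[1+ zero ] f0≡g0
  agree -[1+ suc m ]   = unstep -[1+ suc m ] (agree -[1+ m ])

sumTo-suc : ∀ a n → sumTo a (n + + 1) ≡ sumTo a n + a (n + + 1)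
sumTo-suc a (+ m) rewrite ℕ.+-comm m 1 = refl
sumTo-suc a -[1+ zero ]  = sym (+-inverseˡ (a 0ℤ))
sumTo-suc a -[1+ suc m ] = undo (sumNeg a m) (a -[1+ m ])
  where
  undo : ∀ x y → - x ≡ - (x + y) + y
  undo = solve-∀

signℤ-suc : ∀ k → signℤ (k + + 1) ≡ - signℤ k
signℤ-suc (+ m) rewrite ℕ.+-comm m 1 = refl
signℤ-suc -[1+ zero ]  = refl
signℤ-suc -[1+ suc m ] = sym (neg-involutive _)

IsFibonacciLike : (ℤ → ℤ) → Set
IsFibonacciLike G = ∀ n → G (n + + 2) ≡ G (n + + 1) + G n

fib-isFibonacciLike : IsFibonacciLike fib
fib-isFibonacciLike (+ m) rewrite ℕ.+-comm m 2 | ℕ.+-comm m 1 = refl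
fib-isFibonacciLike -[1+ zero ]        = refl
fib-isFibonacciLike -[1+ suc zero ]    = refl
fib-isFibonacciLike -[1+ suc (suc k) ] = begin
  s * + a                                 ≡⟨ signed-rec s (+ a) (+ b) ⟩
  - s * + b + - - s * (+ b + + a)         ≡⟨ cong (λ x → - s * + b + - - s * x) (pos-+ b a) ⟨
  - s * + b + - - s * + (b ℕ.+ a)         ∎
  where
  s = negOnePow k
  a = fibℕ (suc k)
  b = fibℕ (suc (suc k))
  signed-rec : ∀ s x y → s * x ≡ - s * y + - - s * (y + x)
  signed-rec = solve-∀

shift-isFibonacciLike : ∀ {G} → IsFibonacciLike G → ∀ n → IsFibonacciLike (λ i → G (n + i))
shift-isFibonacciLike {G} rec n i = begin
  G (n + (i + + 2))             ≡⟨ cong G (+-assoc n i (+ 2)) ⟨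
  G (n + i + + 2)               ≡⟨ rec (n + i) ⟩
  G (n + i + + 1) + G (n + i)   ≡⟨ cong (λ j → G j + G (n + i)) (+-assoc n i (+ 1)) ⟩
  G (n + (i + + 1)) + G (n + i) ∎

consecutive-quartic : ∀ a b c d e f g → c ≡ b + a → d ≡ c + b → e ≡ d + c → f ≡ e + d → g ≡ f + e →
  d * e * b * g + c * d * a * f ≡ + 3 * (d * d * d * d)
consecutive-quartic a b _ _ _ _ _ refl refl refl refl refl = solve (a ∷ b ∷ [])

fibonacciLike-quartic : ∀ {G} → IsFibonacciLike G → ∀ n →
  G (n + + 1) * G (n + + 2) * G (n - + 1) * G (n + + 4) + G n * G (n + + 1) * G (n - + 2) * G (n + + 3)
    ≡ + 3 * (G (n + + 1) * G (n + + 1) * G (n + + 1) * G (n + + 1))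
fibonacciLike-quartic {G} rec n =
  trans (cong (λ m → G (n + + 1) * G (n + + 2) * G (n - + 1) * G (n + + 4) + G m * G (n + + 1) * G (n - + 2) * G (n + + 3))
              (sym (+-identityʳ n)))
        (consecutive-quartic _ _ _ _ _ _ _ (H-rec (- + 2)) (H-rec (- + 1)) (H-rec 0ℤ) (H-rec (+ 1)) (H-rec (+ 2)))
  where
  -- at a literal offset i the indices n + (i + + 2), n + (i + + 1) compute to literal offsets
  H-rec : IsFibonacciLike (λ i → G (n + i))
  H-rec = shift-isFibonacciLike {G} rec n

summand : ℤ → ℤ
summand k = signℤ (k - + 1) * fib k ^ 4

closedForm : ℤ → ℤ
closedForm n = signℤ (n - + 1) * fib n * fib (n + + 1) * fib (n - + 2) * fib (n + + 3)

alternating-step : ∀ s t a b c d e f g h k → t ≡ - s → a * b * c * d + e * f * g * h ≡ + 3 * (k * k * k * k) →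
  t * a * b * c * d ≡ s * e * f * g * h + + 3 * (t * k ^ 4)
alternating-step s _ a b c d e f g h k refl eq = begin
  - s * a * b * c * d                                       ≡⟨ solve (s ∷ a ∷ b ∷ c ∷ d ∷ e ∷ f ∷ g ∷ h ∷ []) ⟩
  s * e * f * g * h + - s * (a * b * c * d + e * f * g * h) ≡⟨ cong (λ x → s * e * f * g * h + - s * x) eq ⟩
  s * e * f * g * h + - s * (+ 3 * (k * k * k * k))         ≡⟨ solve (s ∷ e ∷ f ∷ g ∷ h ∷ k ∷ []) ⟩
  s * e * f * g * h + + 3 * (- s * (k * (k * (k * (k * + 1))))) ∎
  -- the last line is - s * k ^ 4 unfolded: the ring solver does not recognise the integer _^_

closedForm-step : ∀ n → closedForm (n + + 1) ≡ closedForm n + + 3 * summand (n + + 1)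
closedForm-step n rewrite +-assoc n (+ 1) (+ 1) | +-assoc n (+ 1) (- + 2) | +-assoc n (+ 1) (+ 3) =
  alternating-step _ _ _ _ _ _ _ _ _ _ (fib (n + + 1)) sign-flips (fibonacciLike-quartic {fib} fib-isFibonacciLike n)
  where
  sign-flips : signℤ (n + + 1 - + 1) ≡ - signℤ (n - + 1)
  sign-flips = trans (cong signℤ (trans (+-assoc n (+ 1) (- + 1)) (sym (+-assoc n (- + 1) (+ 1)))))
                     (signℤ-suc (n - + 1))

mainTheorem9 : (n : ℤ) →
    + 3 * sumTo (λ k → signℤ (k - + 1) * (fib k ^ 4)) n
      ≡ signℤ (n - + 1) * fib n * fib (n + + 1) * fib (n - + 2) * fib (n + + 3)
mainTheorem9 = same-increments⇒≡ (λ n → + 3 * sumTo summand n) closedForm (λ n → + 3 * summand (n + + 1))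
  refl scaledSum-step closedForm-step
  where
  scaledSum-step : ∀ n → + 3 * sumTo summand (n + + 1) ≡ + 3 * sumTo summand n + + 3 * summand (n + + 1)
  scaledSum-step n = trans (cong (+ 3 *_) (sumTo-suc summand n)) (*-distribˡ-+ (+ 3) (sumTo summand n) (summand (n + + 1)))
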